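{- If $D$ is an open irredundant dominating set of a graph $G$, then for any graph $H$ the set $D \times V(H)$ is an open irredundant, minimal dominating set of $G \,\square\, H$.
   Context: All graphs are finite, simple and undirected. A dominating set of $X$ is a set $D$ of vertices such that every vertex is in $D$ or adjacent to a vertex of $D$; it is minimal if no proper subset is dominating. For $u\in A\subseteq V(X)$, the external private neighborhood of $u$ with respect to $A$ is $\mathrm{epn}[u,A]=N(u)-N[A-\{u\}]$, i.e. the neighbors of $u$ that are not in $A$ and not adjacent to any vertex of $A-\{u\}$. $A$ is open irredundant if $\mathrm{epn}[u,A]\ne\emptyset$ for every $u\in A$. The Cartesian product $G\,\square\, H$ has vertex set $V(G)\times V(H)$, with $(g_1,h_1)\sim(g_2,h_2)$ iff either $g_1=g_2$ and $h_1h_2\in E(H)$, or $h_1=h_2$ and $g_1g_2\in E(G)$. -}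

module Defs where

open import Level using (0ℓ)
open import Data.Nat using (ℕ)
open import Data.Fin using (Fin)
open import Data.Product using (Σ; ∃; _×_; _,_; proj₁; proj₂)
open import Data.Sum using (_⊎_; inj₁; inj₂)
open import Data.Empty using (⊥)
open import Relation.Nullary using (¬_)
open import Relation.Binary.PropositionalEquality using (_≡_)
import Relation.Binary.PropositionalEquality as Eq
open import Function.Bundles using (_↔_)
open import Function.Properties.Inverse using (↔-sym; ↔-trans)
open import Data.Fin.Properties using (*↔×)
open import Data.Product.Function.NonDependent.Propositional using (_×-↔_)
import Data.Nat

record Graph : Set₁ where
  field
    V        : Set
    size     : ℕ
    finite   : V ↔ Fin size
    Adj      : V → V → Set
    irrefl   : ∀ {x} → ¬ Adj x x
    sym      : ∀ {x y} → Adj x y → Adj y x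
open Graph public

VSet : Graph → Set₁
VSet G = V G → Set

Subset : (G : Graph) → VSet G → VSet G → Set
Subset G A B = ∀ (x : V G) → A x → B x

ProperSubset : (G : Graph) → VSet G → VSet G → Set
ProperSubset G A B = Subset G A B × (Σ (V G) λ x → B x × ¬ A x)

InClosedNbhd : (G : Graph) → VSet G → V G → Set
InClosedNbhd G A y = A y ⊎ (Σ (V G) λ a → A a × Adj G a y)

Dominating : (G : Graph) → VSet G → Set
Dominating G D = ∀ (y : V G) → InClosedNbhd G D y

MinimalDominating : (G : Graph) → VSet G → Set₁
MinimalDominating G D =
  Dominating G D × (∀ (S : VSet G) → ProperSubset G S D → ¬ Dominating G S)

remove : (G : Graph) → VSet G → V G → VSet G
remove G A u x = A x × ¬ (x ≡ u)

InEpn : (G : Graph) → V G → VSet G → V G → Set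
InEpn G u A w = Adj G u w × ¬ InClosedNbhd G (remove G A u) w

OpenIrredundant : (G : Graph) → VSet G → Set
OpenIrredundant G A = ∀ (u : V G) → A u → Σ (V G) λ w → InEpn G u A w

_□_ : Graph → Graph → Graph
G □ H = record
  { V      = V G × V H
  ; size   = size G Data.Nat.* size H
  ; finite = ↔-trans (finite G ×-↔ finite H) (↔-sym *↔×)
  ; Adj    = adj
  ; irrefl = irr
  ; sym    = sy
  }
  where
  adj : V G × V H → V G × V H → Set
  adj p q = ((proj₁ p ≡ proj₁ q) × Adj H (proj₂ p) (proj₂ q))
          ⊎ ((proj₂ p ≡ proj₂ q) × Adj G (proj₁ p) (proj₁ q))
  irr : ∀ {x} → ¬ adj x x
  irr (inj₁ (_ , a)) = irrefl H a
  irr (inj₂ (_ , a)) = irrefl G a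
  sy : ∀ {x y} → adj x y → adj y x
  sy (inj₁ (e , a)) = inj₁ (Eq.sym e , sym H a)
  sy (inj₂ (e , a)) = inj₂ (Eq.sym e , sym G a)

prodSet : (G H : Graph) → VSet G → VSet (G □ H)
prodSet G H D p = D (proj₁ p)

module Submission where

open import Defs
open import Data.Product using (_×_; _,_)
open import Data.Sum using (inj₁; inj₂)
open import Relation.Binary.PropositionalEquality using (_≡_; refl; cong; subst)
open import Relation.Nullary using (¬_)

-- A private neighbour w of u in G yields the private neighbour (w , h) of (u , h):
-- a vertex of D × V(H) reaching the fibre G × {h} either lies in it or is an
-- H-neighbour of a vertex of D in it, so only G-edges inside the fibre matter.
-- Minimality holds for every open irredundant dominating set: a subset S of A
-- missing u lies in A − {u}, so if S dominated, u would have no private neighbour.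

adj⇒≢ : (G : Graph) {x y : V G} → Adj G x y → ¬ (y ≡ x)
adj⇒≢ G a refl = irrefl G a

closedNbhd-mono : (G : Graph) {A B : VSet G} → Subset G A B →
                  ∀ y → InClosedNbhd G A y → InClosedNbhd G B y
closedNbhd-mono G A⊆B y (inj₁ Ay)             = inj₁ (A⊆B y Ay)
closedNbhd-mono G A⊆B y (inj₂ (a , Aa , a~y)) = inj₂ (a , A⊆B a Aa , a~y)

openIrredundant⇒properSubset-¬dominating :
  (G : Graph) (A : VSet G) → OpenIrredundant G A →
  ∀ (S : VSet G) → ProperSubset G S A → ¬ Dominating G S
openIrredundant⇒properSubset-¬dominating G A irr S (S⊆A , u , Au , ¬Su) domS
  with irr u Au
... | w , _ , w∉N[A-u] = w∉N[A-u] (closedNbhd-mono G S⊆A-u w (domS w))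
  where
  S⊆A-u : Subset G S (remove G A u)
  S⊆A-u x Sx = S⊆A x Sx , λ x≡u → ¬Su (subst S x≡u Sx)

openIrredundant∧dominating⇒minimalDominating :
  (G : Graph) (A : VSet G) → OpenIrredundant G A → Dominating G A →
  MinimalDominating G A
openIrredundant∧dominating⇒minimalDominating G A irr dom =
  dom , openIrredundant⇒properSubset-¬dominating G A irr

module _ (G H : Graph) (D : VSet G) where

  prodSet-dominating : Dominating G D → Dominating (G □ H) (prodSet G H D)
  prodSet-dominating dom (x , h) with dom x
  ... | inj₁ Dx              = inj₁ Dx
  ... | inj₂ (a , Da , a~x) = inj₂ ((a , h) , Da , inj₂ (refl , a~x))

  closedNbhd-prodSet-fibre :
    ∀ {u w h} → ¬ (w ≡ u) →
    InClosedNbhd (G □ H) (remove (G □ H) (prodSet G H D) (u , h)) (w , h) →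
    InClosedNbhd G (remove G D u) w
  closedNbhd-prodSet-fibre w≢u (inj₁ (Dw , _)) = inj₁ (Dw , w≢u)
  closedNbhd-prodSet-fibre w≢u (inj₂ (_ , (Dw , _) , inj₁ (refl , _))) =
    inj₁ (Dw , w≢u)
  closedNbhd-prodSet-fibre {h = h} _ (inj₂ ((a , _) , (Da , a≢u) , inj₂ (refl , a~w))) =
    inj₂ (a , (Da , λ a≡u → a≢u (cong (_, h) a≡u)) , a~w)

  prodSet-openIrredundant :
    OpenIrredundant G D → OpenIrredundant (G □ H) (prodSet G H D)
  prodSet-openIrredundant irr (u , h) Du with irr u Du
  ... | w , u~w , w∉N[D-u] =
    (w , h) , inj₂ (refl , u~w) ,
    λ inN → w∉N[D-u] (closedNbhd-prodSet-fibre (adj⇒≢ G u~w) inN)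

lemma4 : (G H : Graph) (D : VSet G) →
    OpenIrredundant G D → Dominating G D →
    OpenIrredundant (G □ H) (prodSet G H D) × MinimalDominating (G □ H) (prodSet G H D)
lemma4 G H D irr dom =
  irrP , openIrredundant∧dominating⇒minimalDominating (G □ H) (prodSet G H D)
           irrP (prodSet-dominating G H D dom)
  where
  irrP : OpenIrredundant (G □ H) (prodSet G H D)
  irrP = prodSet-openIrredundant G H D irr
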